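{- For all integers $p$ and $n$, \[ Q_{ - n} P_{p} - P_{p-n} = Q_nP_{p + n} -P_{p + 2n} \] and \[ P_pP_{ -n-3}-P_{p+1}P_{ -n-4}=P_{p+n+1}P_{n-4}-P_{p+n}P_{n-3}. \]
   Context: The Padovan numbers $P_n$ are defined for all integers $n$ by $P_0=P_1=P_2=1$ and $P_n=P_{n-2}+P_{n-3}$ for all integers $n$ (extended to negative indices via $P_n=P_{n+3}-P_{n+1}$). The Perrin numbers $Q_n$ are defined for all integers $n$ by $Q_0=3$, $Q_1=0$, $Q_2=2$ and $Q_n=Q_{n-2}+Q_{n-3}$ for all integers $n$. -}

module Defs where

open import Data.Nat using (ℕ; zero; suc)
open import Data.Integer using (ℤ; +_; -[1+_]; _+_; _-_)
open import Data.Product using (_×_; _,_; proj₁)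

-- A state (x_k , x_{k+1} , x_{k+2}) of a sequence satisfying
-- x_{n} = x_{n-2} + x_{n-3} for all integers n.
Triple : Set
Triple = ℤ × ℤ × ℤ

fwd : Triple → Triple
fwd (a , b , c) = (b , c , a + b)

bwd : Triple → Triple
bwd (a , b , c) = (c - a , a , b)

iter : (Triple → Triple) → ℕ → Triple → Triple
iter f zero t = t
iter f (suc n) t = f (iter f n t)

seqℤ : Triple → ℤ → ℤ
seqℤ init (+ n)      = proj₁ (iter fwd n init)
seqℤ init -[1+ m ]   = proj₁ (iter bwd (suc m) init)

P : ℤ → ℤ
P = seqℤ (+ 1 , + 1 , + 1)

Q : ℤ → ℤ
Q = seqℤ (+ 3 , + 0 , + 2)

module Submission where

-- Let R = ℤ[t]/(t³ - t - 1), with an element a + b·t + c·t² stored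
-- as the triple (a , b , c).  The root t is a unit (t⁻¹ = t² - 1), and for every
-- integer-indexed sequence x with x(k+3) = x(k+1) + x(k) and initial state
-- x₀ = (x(0) , x(1) , x(2)) we have the closed form
--     x(m) = ⟨ x₀ ∣ tᵐ ⟩     where ⟨ (a,b,c) ∣ (d,e,f) ⟩ = a·d + b·e + c·f.
-- The map adj u = u'·u'' (product of the two other conjugates) is multiplicative
-- and swaps t and t⁻¹, hence t⁻ᵐ = adj (tᵐ).  Writing every index occurring in
-- the theorem as a sum of p, ±n and a constant, both identities become
-- polynomial identities in the coordinates of u = tᵖ and v = tⁿ, which the ring
-- solver verifies; the first one is Cayley–Hamilton for v and holds for every
-- solution x of the recurrence, not only for the Padovan numbers.

open import Defs
open import Data.Nat using (ℕ; zero; suc)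
open import Data.Integer using (ℤ; +_; -[1+_]; -_; _+_; _-_; _*_)
open import Data.Product using (_×_; _,_; proj₁; proj₂)
open import Function using (id)
open import Relation.Binary.PropositionalEquality
  using (_≡_; refl; sym; trans; cong; cong₂; module ≡-Reasoning)
import Data.Integer.Properties as ℤ
open import Algebra.Properties.CommutativeSemigroup ℤ.+-commutativeSemigroup
  using () renaming (x∙yz≈y∙xz to +-leftComm)
open import Data.Integer.Solver using (module +-*-Solver)
open +-*-Solver using (Polynomial; con; _:+_; _:*_; _:-_; _:=_; solve)

module CubicRing {A : Set} (plus times : A → A → A) (lit : ℤ → A) where
  infixl 6 _⊕_
  infixl 7 _⊗_ _·_

  _⊕_ _⊗_ : A → A → A
  _⊕_ = plus
  _⊗_ = times

  Elt : Set
  Elt = A × A × A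

  -- (a + bt + ct²)(d + et + ft²), reduced with t³ = t + 1 and t⁴ = t² + t.
  _·_ : Elt → Elt → Elt
  (a , b , c) · (d , e , f) =
    ( a ⊗ d ⊕ b ⊗ f ⊕ c ⊗ e
    , a ⊗ e ⊕ b ⊗ d ⊕ b ⊗ f ⊕ c ⊗ e ⊕ c ⊗ f
    , a ⊗ f ⊕ b ⊗ e ⊕ c ⊗ d ⊕ c ⊗ f )

  -- The product of the two conjugates of u other than u itself, so that
  -- u · adj u is the norm of u.
  adj : Elt → Elt
  adj (a , b , c) =
    ( a ⊗ a ⊕ lit (+ 2) ⊗ a ⊗ c ⊕ lit (-[1+ 0 ]) ⊗ b ⊗ b ⊕ lit (-[1+ 0 ]) ⊗ b ⊗ c ⊕ c ⊗ c
    , c ⊗ c ⊕ lit (-[1+ 0 ]) ⊗ a ⊗ b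
    , b ⊗ b ⊕ lit (-[1+ 0 ]) ⊗ a ⊗ c ⊕ lit (-[1+ 0 ]) ⊗ c ⊗ c )

  ⟨_∣_⟩ : Elt → Elt → A
  ⟨ (x , y , z) ∣ (a , b , c) ⟩ = x ⊗ a ⊕ y ⊗ b ⊕ z ⊗ c

  𝟙 t t⁻¹ t⁻³ t⁻⁴ P₀ Q₀ : Elt
  𝟙   = (lit (+ 1) , lit (+ 0) , lit (+ 0))
  t   = (lit (+ 0) , lit (+ 1) , lit (+ 0))
  t⁻¹ = (lit (-[1+ 0 ]) , lit (+ 0) , lit (+ 1))
  t⁻³ = (lit (+ 0) , lit (-[1+ 0 ]) , lit (+ 1))
  t⁻⁴ = (lit (-[1+ 0 ]) , lit (+ 1) , lit (+ 0))
  P₀  = (lit (+ 1) , lit (+ 1) , lit (+ 1))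
  Q₀  = (lit (+ 3) , lit (+ 0) , lit (+ 2))

-- R itself, and its copy over the solver's polynomial syntax: each identity in
-- R below is proved by normalising the corresponding syntactic expressions.
open CubicRing {ℤ} _+_ _*_ id
module Syn {n : ℕ} = CubicRing {Polynomial n} _:+_ _:*_ con

coords≡ : ∀ {a b c a′ b′ c′ : ℤ} → a ≡ a′ → b ≡ b′ → c ≡ c′ → (a , b , c) ≡ (a′ , b′ , c′)
coords≡ p q r = cong₂ _,_ p (cong₂ _,_ q r)

·-assoc : ∀ u v w → (u · v) · w ≡ u · (v · w)
·-assoc (a , b , c) (d , e , f) (g , h , i) = coords≡
  (solve 9 (λ a b c d e f g h i → proj₁ ((a , b , c) Syn.· (d , e , f) Syn.· (g , h , i))
                               := proj₁ ((a , b , c) Syn.· ((d , e , f) Syn.· (g , h , i)))) refl a b c d e f g h i)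
  (solve 9 (λ a b c d e f g h i → proj₁ (proj₂ ((a , b , c) Syn.· (d , e , f) Syn.· (g , h , i)))
                               := proj₁ (proj₂ ((a , b , c) Syn.· ((d , e , f) Syn.· (g , h , i))))) refl a b c d e f g h i)
  (solve 9 (λ a b c d e f g h i → proj₂ (proj₂ ((a , b , c) Syn.· (d , e , f) Syn.· (g , h , i)))
                               := proj₂ (proj₂ ((a , b , c) Syn.· ((d , e , f) Syn.· (g , h , i))))) refl a b c d e f g h i)

·-identityʳ : ∀ u → u · 𝟙 ≡ u
·-identityʳ (a , b , c) = coords≡
  (solve 3 (λ a b c → proj₁ ((a , b , c) Syn.· Syn.𝟙) := a) refl a b c)
  (solve 3 (λ a b c → proj₁ (proj₂ ((a , b , c) Syn.· Syn.𝟙)) := b) refl a b c)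
  (solve 3 (λ a b c → proj₂ (proj₂ ((a , b , c) Syn.· Syn.𝟙)) := c) refl a b c)

-- adj is multiplicative (it is the product of two ring homomorphisms into
-- the splitting field).
adj-· : ∀ u v → adj (u · v) ≡ adj u · adj v
adj-· (a , b , c) (d , e , f) = coords≡
  (solve 6 (λ a b c d e f → proj₁ (Syn.adj ((a , b , c) Syn.· (d , e , f)))
                         := proj₁ (Syn.adj (a , b , c) Syn.· Syn.adj (d , e , f))) refl a b c d e f)
  (solve 6 (λ a b c d e f → proj₁ (proj₂ (Syn.adj ((a , b , c) Syn.· (d , e , f))))
                         := proj₁ (proj₂ (Syn.adj (a , b , c) Syn.· Syn.adj (d , e , f)))) refl a b c d e f)
  (solve 6 (λ a b c d e f → proj₂ (proj₂ (Syn.adj ((a , b , c) Syn.· (d , e , f))))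
                         := proj₂ (proj₂ (Syn.adj (a , b , c) Syn.· Syn.adj (d , e , f)))) refl a b c d e f)

t⁻¹-inverseˡ : t⁻¹ · t ≡ 𝟙
t⁻¹-inverseˡ = refl

t⁻¹-inverseʳ : t · t⁻¹ ≡ 𝟙
t⁻¹-inverseʳ = refl

·-cancel-t : ∀ u → u · t⁻¹ · t ≡ u
·-cancel-t u = trans (·-assoc u t⁻¹ t) (trans (cong (u ·_) t⁻¹-inverseˡ) (·-identityʳ u))

·-cancel-t⁻¹ : ∀ u → u · t · t⁻¹ ≡ u
·-cancel-t⁻¹ u = trans (·-assoc u t t⁻¹) (trans (cong (u ·_) t⁻¹-inverseʳ) (·-identityʳ u))

⟨∣⟩-𝟙 : ∀ x → ⟨ x ∣ 𝟙 ⟩ ≡ proj₁ x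
⟨∣⟩-𝟙 (x₀ , x₁ , x₂) = solve 3 (λ x₀ x₁ x₂ → Syn.⟨ (x₀ , x₁ , x₂) ∣ Syn.𝟙 ⟩ := x₀) refl x₀ x₁ x₂

⟨∣⟩-t : ∀ x u → ⟨ x ∣ u · t ⟩ ≡ ⟨ fwd x ∣ u ⟩
⟨∣⟩-t (x₀ , x₁ , x₂) (a , b , c) =
  solve 6 (λ x₀ x₁ x₂ a b c → Syn.⟨ (x₀ , x₁ , x₂) ∣ (a , b , c) Syn.· Syn.t ⟩
                            := Syn.⟨ (x₁ , x₂ , x₀ :+ x₁) ∣ (a , b , c) ⟩) refl x₀ x₁ x₂ a b c

⟨∣⟩-t⁻¹ : ∀ x u → ⟨ x ∣ u · t⁻¹ ⟩ ≡ ⟨ bwd x ∣ u ⟩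
⟨∣⟩-t⁻¹ (x₀ , x₁ , x₂) (a , b , c) =
  solve 6 (λ x₀ x₁ x₂ a b c → Syn.⟨ (x₀ , x₁ , x₂) ∣ (a , b , c) Syn.· Syn.t⁻¹ ⟩
                            := Syn.⟨ (x₂ :- x₀ , x₀ , x₁) ∣ (a , b , c) ⟩) refl x₀ x₁ x₂ a b c

infixr 8 _^_
_^_ : Elt → ℕ → Elt
g ^ zero  = 𝟙
g ^ suc k = g ^ k · g

t^_ : ℤ → Elt
t^ (+ k)      = t ^ k
t^ -[1+ k ]   = t⁻¹ ^ suc k

adj-^ : ∀ g k → adj (g ^ k) ≡ adj g ^ k
adj-^ g zero    = refl
adj-^ g (suc k) = trans (adj-· (g ^ k) g) (cong (_· adj g) (adj-^ g k))

-- adj swaps t and t⁻¹, so it inverts every power of t.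
t^-neg : ∀ m → t^ (- m) ≡ adj (t^ m)
t^-neg (+ zero)   = refl
t^-neg (+ suc k)  = sym (adj-^ t (suc k))
t^-neg -[1+ k ]   = sym (adj-^ t⁻¹ (suc k))

t^-suc : ∀ m → t^ (+ 1 + m) ≡ t^ m · t
t^-suc (+ k)          = refl
t^-suc -[1+ zero ]    = sym (·-cancel-t 𝟙)
t^-suc -[1+ suc k ]   = sym (·-cancel-t (t⁻¹ ^ suc k))

t^-pred : ∀ m → t^ (-[1+ 0 ] + m) ≡ t^ m · t⁻¹
t^-pred (+ zero)   = refl
t^-pred (+ suc k)  = sym (·-cancel-t⁻¹ (t ^ k))
t^-pred -[1+ k ]   = refl

t^-+ : ∀ m k → t^ (m + k) ≡ t^ m · t^ k
t^-+ m (+ zero)        = trans (cong t^_ (ℤ.+-identityʳ m)) (sym (·-identityʳ (t^ m)))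
t^-+ m (+ suc k)       = begin
  t^ (m + (+ 1 + + k))    ≡⟨ cong t^_ (+-leftComm m (+ 1) (+ k)) ⟩
  t^ (+ 1 + (m + + k))    ≡⟨ t^-suc (m + + k) ⟩
  t^ (m + + k) · t        ≡⟨ cong (_· t) (t^-+ m (+ k)) ⟩
  t^ m · t^ (+ k) · t     ≡⟨ ·-assoc (t^ m) (t^ (+ k)) t ⟩
  t^ m · t^ (+ suc k)     ∎
  where open ≡-Reasoning
t^-+ m -[1+ zero ]     = trans (cong t^_ (ℤ.+-comm m (-[1+ 0 ]))) (t^-pred m)
t^-+ m -[1+ suc k ]    = begin
  t^ (m + (-[1+ 0 ] + -[1+ k ]))   ≡⟨ cong t^_ (+-leftComm m (-[1+ 0 ]) (-[1+ k ])) ⟩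
  t^ (-[1+ 0 ] + (m + -[1+ k ]))   ≡⟨ t^-pred (m + -[1+ k ]) ⟩
  t^ (m + -[1+ k ]) · t⁻¹          ≡⟨ cong (_· t⁻¹) (t^-+ m (-[1+ k ])) ⟩
  t^ m · t^ -[1+ k ] · t⁻¹         ≡⟨ ·-assoc (t^ m) (t^ -[1+ k ]) t⁻¹ ⟩
  t^ m · t^ -[1+ suc k ]           ∎
  where open ≡-Reasoning

iter-comm : ∀ (f : Triple → Triple) k x → iter f k (f x) ≡ f (iter f k x)
iter-comm f zero    x = refl
iter-comm f (suc k) x = cong f (iter-comm f k x)

iter-pairing : ∀ (f : Triple → Triple) g → (∀ x u → ⟨ x ∣ u · g ⟩ ≡ ⟨ f x ∣ u ⟩) →
               ∀ k x → proj₁ (iter f k x) ≡ ⟨ x ∣ g ^ k ⟩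
iter-pairing f g step zero    x = sym (⟨∣⟩-𝟙 x)
iter-pairing f g step (suc k) x = begin
  proj₁ (f (iter f k x))   ≡⟨ cong proj₁ (sym (iter-comm f k x)) ⟩
  proj₁ (iter f k (f x))   ≡⟨ iter-pairing f g step k (f x) ⟩
  ⟨ f x ∣ g ^ k ⟩          ≡⟨ sym (step x (g ^ k)) ⟩
  ⟨ x ∣ g ^ k · g ⟩        ∎
  where open ≡-Reasoning

seq-closed : ∀ x m → seqℤ x m ≡ ⟨ x ∣ t^ m ⟩
seq-closed x (+ k)     = iter-pairing fwd t ⟨∣⟩-t k x
seq-closed x -[1+ k ]  = iter-pairing bwd t⁻¹ ⟨∣⟩-t⁻¹ (suc k) x

seq-at : ∀ x m {w} → t^ m ≡ w → seqℤ x m ≡ ⟨ x ∣ w ⟩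
seq-at x m tᵐ≡w = trans (seq-closed x m) (cong ⟨ x ∣_⟩ tᵐ≡w)

-- The first identity in R: apply the linear form ⟨ x ∣ u · _ ⟩ to the
-- Cayley–Hamilton relation adj v = v² - tr(v)·v + tr(adj v), where the trace
-- tr w = ⟨ Q₀ ∣ w ⟩ (the Perrin numbers are the power sums of the conjugates of t).
cayley-hamilton : ∀ x u v →
  ⟨ Q₀ ∣ adj v ⟩ * ⟨ x ∣ u ⟩ - ⟨ x ∣ u · adj v ⟩ ≡ ⟨ Q₀ ∣ v ⟩ * ⟨ x ∣ u · v ⟩ - ⟨ x ∣ u · (v · v) ⟩
cayley-hamilton (x₀ , x₁ , x₂) (a , b , c) (d , e , f) =
  solve 9 (λ x₀ x₁ x₂ a b c d e f →
      let x = (x₀ , x₁ , x₂) ; u = (a , b , c) ; v = (d , e , f) in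
      Syn.⟨ Syn.Q₀ ∣ Syn.adj v ⟩ :* Syn.⟨ x ∣ u ⟩ :- Syn.⟨ x ∣ u Syn.· Syn.adj v ⟩
      := Syn.⟨ Syn.Q₀ ∣ v ⟩ :* Syn.⟨ x ∣ u Syn.· v ⟩ :- Syn.⟨ x ∣ u Syn.· (v Syn.· v) ⟩)
    refl x₀ x₁ x₂ a b c d e f

padovan-identity : ∀ u v →
  ⟨ P₀ ∣ u ⟩ * ⟨ P₀ ∣ adj v · t⁻³ ⟩ - ⟨ P₀ ∣ u · t ⟩ * ⟨ P₀ ∣ adj v · t⁻⁴ ⟩
  ≡ ⟨ P₀ ∣ u · v · t ⟩ * ⟨ P₀ ∣ v · t⁻⁴ ⟩ - ⟨ P₀ ∣ u · v ⟩ * ⟨ P₀ ∣ v · t⁻³ ⟩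
padovan-identity (a , b , c) (d , e , f) =
  solve 6 (λ a b c d e f →
      let u = (a , b , c) ; v = (d , e , f) in
      Syn.⟨ Syn.P₀ ∣ u ⟩ :* Syn.⟨ Syn.P₀ ∣ Syn.adj v Syn.· Syn.t⁻³ ⟩
        :- Syn.⟨ Syn.P₀ ∣ u Syn.· Syn.t ⟩ :* Syn.⟨ Syn.P₀ ∣ Syn.adj v Syn.· Syn.t⁻⁴ ⟩
      := Syn.⟨ Syn.P₀ ∣ u Syn.· v Syn.· Syn.t ⟩ :* Syn.⟨ Syn.P₀ ∣ v Syn.· Syn.t⁻⁴ ⟩
        :- Syn.⟨ Syn.P₀ ∣ u Syn.· v ⟩ :* Syn.⟨ Syn.P₀ ∣ v Syn.· Syn.t⁻³ ⟩)
    refl a b c d e f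

shifted-product-identity : ∀ x p n →
  Q (- n) * seqℤ x p - seqℤ x (p - n) ≡ Q n * seqℤ x (p + n) - seqℤ x (p + (+ 2) * n)
shifted-product-identity x p n = begin
  Q (- n) * seqℤ x p - seqℤ x (p - n)
    ≡⟨ cong₂ _-_ (cong₂ _*_ (seq-at Q₀ (- n) (t^-neg n)) (seq-closed x p))
                 (seq-at x (p - n) (trans (t^-+ p (- n)) (cong (U ·_) (t^-neg n)))) ⟩
  ⟨ Q₀ ∣ adj V ⟩ * ⟨ x ∣ U ⟩ - ⟨ x ∣ U · adj V ⟩
    ≡⟨ cayley-hamilton x U V ⟩
  ⟨ Q₀ ∣ V ⟩ * ⟨ x ∣ U · V ⟩ - ⟨ x ∣ U · (V · V) ⟩
    ≡⟨ sym (cong₂ _-_ (cong₂ _*_ (seq-closed Q₀ n) (seq-at x (p + n) (t^-+ p n)))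
                      (seq-at x (p + + 2 * n) t^[p+2n])) ⟩
  Q n * seqℤ x (p + n) - seqℤ x (p + (+ 2) * n) ∎
  where
  open ≡-Reasoning
  U V : Elt
  U = t^ p
  V = t^ n
  2n≡n+n : + 2 * n ≡ n + n
  2n≡n+n = trans (ℤ.*-distribʳ-+ n (+ 1) (+ 1)) (cong₂ _+_ (ℤ.*-identityˡ n) (ℤ.*-identityˡ n))
  t^[p+2n] : t^ (p + + 2 * n) ≡ U · (V · V)
  t^[p+2n] = trans (cong (λ j → t^ (p + j)) 2n≡n+n) (trans (t^-+ p (n + n)) (cong (U ·_) (t^-+ n n)))

-- Second identity, for the Padovan numbers.  The constants t^(-3), t^(-4)
-- compute to t⁻³, t⁻⁴, which is how padovan-identity applies.
padovan-cross-identity : ∀ p n →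
  P p * P (- n - + 3) - P (p + + 1) * P (- n - + 4)
  ≡ P (p + n + + 1) * P (n - + 4) - P (p + n) * P (n - + 3)
padovan-cross-identity p n = begin
  P p * P (- n - + 3) - P (p + + 1) * P (- n - + 4)
    ≡⟨ cong₂ _-_ (cong₂ _*_ (seq-closed P₀ p) (seq-at P₀ (- n - + 3) (t^[-n-c] (+ 3))))
                 (cong₂ _*_ (seq-at P₀ (p + + 1) (t^-+ p (+ 1))) (seq-at P₀ (- n - + 4) (t^[-n-c] (+ 4)))) ⟩
  ⟨ P₀ ∣ U ⟩ * ⟨ P₀ ∣ adj V · t⁻³ ⟩ - ⟨ P₀ ∣ U · t ⟩ * ⟨ P₀ ∣ adj V · t⁻⁴ ⟩
    ≡⟨ padovan-identity U V ⟩
  ⟨ P₀ ∣ U · V · t ⟩ * ⟨ P₀ ∣ V · t⁻⁴ ⟩ - ⟨ P₀ ∣ U · V ⟩ * ⟨ P₀ ∣ V · t⁻³ ⟩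
    ≡⟨ sym (cong₂ _-_ (cong₂ _*_ (seq-at P₀ (p + n + + 1) t^[p+n+1]) (seq-at P₀ (n - + 4) (t^-+ n (- + 4))))
                      (cong₂ _*_ (seq-at P₀ (p + n) (t^-+ p n)) (seq-at P₀ (n - + 3) (t^-+ n (- + 3))))) ⟩
  P (p + n + + 1) * P (n - + 4) - P (p + n) * P (n - + 3) ∎
  where
  open ≡-Reasoning
  U V : Elt
  U = t^ p
  V = t^ n
  t^[-n-c] : ∀ c → t^ (- n - c) ≡ adj V · t^ (- c)
  t^[-n-c] c = trans (t^-+ (- n) (- c)) (cong (_· t^ (- c)) (t^-neg n))
  t^[p+n+1] : t^ (p + n + + 1) ≡ U · V · t
  t^[p+n+1] = trans (t^-+ (p + n) (+ 1)) (cong (_· t) (t^-+ p n))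

theorem6 : ∀ (p n : ℤ) →
    (Q (- n) * P p - P (p - n) ≡ Q n * P (p + n) - P (p + (+ 2) * n))
    × (P p * P (- n - + 3) - P (p + + 1) * P (- n - + 4)
         ≡ P (p + n + + 1) * P (n - + 4) - P (p + n) * P (n - + 3))
theorem6 p n = shifted-product-identity P₀ p n , padovan-cross-identity p n
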